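{- Let $G$ be a finite simple connected graph and let $k$ be a positive integer. If $G$ has a $k$-wide subgraph $H$, then $c_{\infty}(G) \geq k$.
   Context: Cops and Robber game with a fast robber: it is played on a finite simple connected graph $G$ by a set of cops and one robber. First the cops choose initial vertices (several cops may share a vertex), then the robber, knowing their positions, chooses a vertex. Then the players move in alternate rounds, cops first. In the cops' turn each cop either stays or moves to an adjacent vertex. In the robber's turn she may stay, or move along any path of $G$ starting at her current vertex that contains no vertex occupied by a cop. The cops win if at some point a cop moves onto the robber's vertex; the robber wins if she evades capture forever. $c_{\infty}(G)$ denotes the minimum number of cops that guarantees a win for the cops. For $A \subseteq V(G)$, $N(A)$ is the set of vertices having a neighbour in $A$, and $\overline{N}(A) = A \cup N(A)$. A subgraph $H$ of $G$ is $k$-wide if (i) $H$ is $k$-connected, and (ii) for every $S \subseteq V(G)$ with $|S| < k$ we have $V(H) \not\subseteq \overline{N}(S)$. -}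

module Defs where

open import Data.Nat using (ℕ; _<_; _≤_)
open import Data.Bool using (Bool; T)
open import Data.Fin using (Fin)
open import Data.Fin.Subset using (Subset; _∈_; _∉_; ∣_∣)
open import Data.Product using (Σ; ∃; _×_)
open import Data.Sum using (_⊎_)
open import Relation.Nullary using (¬_)
open import Relation.Binary.PropositionalEquality using (_≡_)

record Graph : Set where
  field
    n      : ℕ
    E      : Fin n → Fin n → Bool
    sym    : ∀ u v → T (E u v) → T (E v u)
    irrefl : ∀ v → ¬ T (E v v)

  Adj : Fin n → Fin n → Set
  Adj u v = T (E u v)

open Graph public

data WalkIn {n : ℕ} (P : Fin n → Set) (R : Fin n → Fin n → Set) : Fin n → Fin n → Set where
  here : ∀ {u} → P u → WalkIn P R u u
  step : ∀ {u v w} → P u → R u v → WalkIn P R v w → WalkIn P R u w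

ConnectedOn : {n : ℕ} → (Fin n → Set) → (Fin n → Fin n → Set) → Set
ConnectedOn P R = ∀ u v → P u → P v → WalkIn P R u v

Connected : Graph → Set
Connected G = ConnectedOn {n G} (λ _ → Data.Unit.⊤) (Adj G)
  where import Data.Unit

record Subgraph (G : Graph) : Set where
  field
    VH    : Subset (n G)
    EH    : Fin (n G) → Fin (n G) → Bool
    EH⊆E  : ∀ u v → T (EH u v) → Adj G u v
    EH-in : ∀ u v → T (EH u v) → (u ∈ VH) × (v ∈ VH)
    EH-sym : ∀ u v → T (EH u v) → T (EH v u)

open Subgraph public

-- k-connected (Diestel's convention): more than k vertices, and H - X connected for every |X| < k.
KConnected : {G : Graph} → ℕ → Subgraph G → Set
KConnected {G} k H =
  (k < ∣ VH H ∣) ×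
  (∀ (X : Subset (n G)) → ∣ X ∣ < k →
     ConnectedOn (λ v → (v ∈ VH H) × (v ∉ X)) (λ u v → T (EH H u v)))

InClosedNbhd : (G : Graph) → Subset (n G) → Fin (n G) → Set
InClosedNbhd G S v = (v ∈ S) ⊎ (Σ (Fin (n G)) λ u → (u ∈ S) × Adj G v u)

Wide : (G : Graph) → ℕ → Subgraph G → Set
Wide G k H =
  KConnected k H ×
  (∀ (S : Subset (n G)) → ∣ S ∣ < k → ¬ (∀ v → v ∈ VH H → InClosedNbhd G S v))

Occ : (G : Graph) {m : ℕ} → (Fin m → Fin (n G)) → Fin (n G) → Set
Occ G {m} c v = Σ (Fin m) λ i → c i ≡ v

CopMove : (G : Graph) {m : ℕ} → (Fin m → Fin (n G)) → (Fin m → Fin (n G)) → Set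
CopMove G {m} c c' = ∀ (i : Fin m) → (c' i ≡ c i) ⊎ Adj G (c i) (c' i)

RobberMove : (G : Graph) {m : ℕ} → (Fin m → Fin (n G)) → Fin (n G) → Fin (n G) → Set
RobberMove G c r r' = (r' ≡ r) ⊎ WalkIn (λ v → ¬ Occ G c v) (Adj G) r r'

-- CopsWin c r: position with cops at c, robber at r, cops to move; the cops
-- can force capture (a cop moves onto the robber's vertex) in finitely many rounds.
data CopsWin (G : Graph) {m : ℕ} : (Fin m → Fin (n G)) → Fin (n G) → Set where
  win : ∀ {c r} (c' : Fin m → Fin (n G)) → CopMove G c c' →
        (Occ G c' r ⊎ (∀ r' → RobberMove G c' r r' → CopsWin G c' r')) →
        CopsWin G c r

CopsWinWith : Graph → ℕ → Set
CopsWinWith G m = Σ (Fin m → Fin (n G)) λ c₀ → ∀ r → ¬ Occ G c₀ r → CopsWin G c₀ r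

module Submission where

-- Idea: suppose m < k cops play.  At any moment the set S of occupied vertices
-- has |S| ≤ m < k, so by wideness some vertex of H lies outside N̄(S); call a
-- robber position "safe" if it is such a vertex.  From a safe position the
-- robber survives every cop move (no cop can reach a vertex outside N̄(S)), and
-- afterwards she can run to a new safe position: the new occupied set S' has
-- |S'| < k, so H - S' is connected (k-connectivity) and contains a vertex outside
-- N̄(S'); the H-path between them avoids all cops, hence is a legal robber move.
-- So the robber, starting at a safe vertex, is never caught, contradicting any
-- winning strategy for m < k cops.

open import Defs
open import Data.Nat using (ℕ; _<_; _≤_; zero; suc; _+_; z≤n; s≤s)
open import Data.Nat.Properties
  using (≤-trans; ≤-reflexive; +-mono-≤; +-monoʳ-≤; +-suc; n≤1+n; ≤-<-trans; _≤?_; ≰⇒>)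
open import Data.Bool using (true; false; T)
open import Data.Fin using (Fin) renaming (zero to fzero; suc to fsuc)
open import Data.Fin.Subset using (Subset; _∈_; _∉_; ∣_∣; ⊥; ⁅_⁆; _∪_)
open import Data.Fin.Subset.Properties
  using (x∈p∪q⁺; x∈p∪q⁻; x∈⁅y⁆⇒x≡y; x∈⁅x⁆; ∣⊥∣≡0; ∉⊥; ∣⁅x⁆∣≡1; _∈?_)
open import Data.Fin.Properties using (any?; ¬∀⟶∃¬)
open import Data.Vec using (_∷_; [])
open import Data.Product using (Σ; _×_; _,_; proj₁; proj₂)
open import Data.Sum using (_⊎_; inj₁; inj₂)
open import Data.Empty using (⊥-elim)
open import Relation.Nullary using (¬_; yes; no; Dec)
open import Relation.Nullary.Decidable using (_⊎-dec_; _×-dec_; _→-dec_; T?)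
open import Relation.Binary.PropositionalEquality
  using (_≡_; refl; subst; trans) renaming (sym to ≡-sym)

∣p∪q∣≤∣p∣+∣q∣ : ∀ {N} (p q : Subset N) → ∣ p ∪ q ∣ ≤ ∣ p ∣ + ∣ q ∣
∣p∪q∣≤∣p∣+∣q∣ []          []          = z≤n
∣p∪q∣≤∣p∣+∣q∣ (true ∷ p)  (true ∷ q)  =
  s≤s (≤-trans (∣p∪q∣≤∣p∣+∣q∣ p q) (+-monoʳ-≤ ∣ p ∣ (n≤1+n ∣ q ∣)))
∣p∪q∣≤∣p∣+∣q∣ (true ∷ p)  (false ∷ q) = s≤s (∣p∪q∣≤∣p∣+∣q∣ p q)
∣p∪q∣≤∣p∣+∣q∣ (false ∷ p) (true ∷ q)  =
  ≤-trans (s≤s (∣p∪q∣≤∣p∣+∣q∣ p q)) (≤-reflexive (≡-sym (+-suc ∣ p ∣ ∣ q ∣)))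
∣p∪q∣≤∣p∣+∣q∣ (false ∷ p) (false ∷ q) = ∣p∪q∣≤∣p∣+∣q∣ p q

copSet : ∀ {N m} → (Fin m → Fin N) → Subset N
copSet {m = zero}  c = ⊥
copSet {m = suc m} c = ⁅ c fzero ⁆ ∪ copSet (λ i → c (fsuc i))

position∈copSet : ∀ {N m} (c : Fin m → Fin N) (i : Fin m) → c i ∈ copSet c
position∈copSet {m = suc m} c fzero    = x∈p∪q⁺ (inj₁ (x∈⁅x⁆ (c fzero)))
position∈copSet {m = suc m} c (fsuc i) =
  x∈p∪q⁺ (inj₂ (position∈copSet (λ j → c (fsuc j)) i))

∈copSet⇒position : ∀ {N m} (c : Fin m → Fin N) v → v ∈ copSet c → Σ (Fin m) λ i → c i ≡ v
∈copSet⇒position {m = zero}  c v v∈ = ⊥-elim (∉⊥ v∈)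
∈copSet⇒position {m = suc m} c v v∈
  with x∈p∪q⁻ ⁅ c fzero ⁆ (copSet (λ i → c (fsuc i))) v∈
... | inj₁ v∈head = fzero , ≡-sym (x∈⁅y⁆⇒x≡y (c fzero) v∈head)
... | inj₂ v∈tail with ∈copSet⇒position (λ i → c (fsuc i)) v v∈tail
...   | i , ci≡v = fsuc i , ci≡v

∣copSet∣≤ : ∀ {N m} (c : Fin m → Fin N) → ∣ copSet c ∣ ≤ m
∣copSet∣≤ {N} {zero}  c = ≤-reflexive (∣⊥∣≡0 N)
∣copSet∣≤ {N} {suc m} c =
  ≤-trans (∣p∪q∣≤∣p∣+∣q∣ ⁅ c fzero ⁆ (copSet (λ i → c (fsuc i))))
          (+-mono-≤ (≤-reflexive (∣⁅x⁆∣≡1 (c fzero))) (∣copSet∣≤ (λ i → c (fsuc i))))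

module _ (G : Graph) where

  occupied⇒∈copSet : ∀ {m} (c : Fin m → Fin (n G)) {v} → Occ G c v → v ∈ copSet c
  occupied⇒∈copSet c (i , refl) = position∈copSet c i

  inClosedNbhd? : ∀ S v → Dec (InClosedNbhd G S v)
  inClosedNbhd? S v = (v ∈? S) ⊎-dec any? (λ u → (u ∈? S) ×-dec T? (E G v u))

  vertexOutside : (H : Subgraph G) (S : Subset (n G)) →
                  ¬ (∀ v → v ∈ VH H → InClosedNbhd G S v) →
                  Σ (Fin (n G)) λ v → (v ∈ VH H) × ¬ InClosedNbhd G S v
  vertexOutside H S notCovered
    with ¬∀⟶∃¬ (n G) (λ v → v ∈ VH H → InClosedNbhd G S v)
                (λ v → (v ∈? VH H) →-dec inClosedNbhd? S v) notCovered
  ... | v , v-uncovered with v ∈? VH H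
  ...   | yes v∈H = v , v∈H , (λ v∈N̄ → v-uncovered (λ _ → v∈N̄))
  ...   | no  v∉H = ⊥-elim (v-uncovered (λ v∈H → ⊥-elim (v∉H v∈H)))

  copsCannotReach : ∀ {m} (c c' : Fin m → Fin (n G)) {r} → CopMove G c c' →
                    ¬ InClosedNbhd G (copSet c) r → ¬ Occ G c' r
  copsCannotReach c c' move r∉N̄ (i , c'i≡r) with move i
  ... | inj₁ stayed = r∉N̄ (inj₁ (subst (_∈ copSet c) (trans (≡-sym stayed) c'i≡r)
                                         (position∈copSet c i)))
  ... | inj₂ moved  = r∉N̄ (inj₂ (c i , position∈copSet c i ,
                          sym G (c i) _ (subst (Adj G (c i)) c'i≡r moved)))

  walkInH⇒robberPath : ∀ {m} (H : Subgraph G) (c : Fin m → Fin (n G)) {u v} →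
    WalkIn (λ w → (w ∈ VH H) × (w ∉ copSet c)) (λ x y → T (EH H x y)) u v →
    WalkIn (λ w → ¬ Occ G c w) (Adj G) u v
  walkInH⇒robberPath H c (here (_ , u∉S)) = here (λ occ → u∉S (occupied⇒∈copSet c occ))
  walkInH⇒robberPath H c (step (_ , u∉S) edge walk) =
    step (λ occ → u∉S (occupied⇒∈copSet c occ)) (EH⊆E H _ _ edge) (walkInH⇒robberPath H c walk)

  module FewCops (k : ℕ) (H : Subgraph G) (wide : Wide G k H) (m : ℕ) (m<k : m < k) where

    Safe : (Fin m → Fin (n G)) → Fin (n G) → Set
    Safe c r = (r ∈ VH H) × ¬ InClosedNbhd G (copSet c) r

    fewOccupied : (c : Fin m → Fin (n G)) → ∣ copSet c ∣ < k
    fewOccupied c = ≤-<-trans (∣copSet∣≤ c) m<k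

    safeVertex : (c : Fin m → Fin (n G)) → Σ (Fin (n G)) (Safe c)
    safeVertex c = vertexOutside H (copSet c) (proj₂ wide (copSet c) (fewOccupied c))

    escape : ∀ {c c' r} → CopMove G c c' → Safe c r →
             Σ (Fin (n G)) λ r' → RobberMove G c' r r' × Safe c' r'
    escape {c} {c'} {r} move (r∈H , r∉N̄) with safeVertex c'
    ... | r' , safe'@(r'∈H , r'∉N̄') = r' , inj₂ (walkInH⇒robberPath H c' pathInH) , safe'
      where
        r∉S' : r ∉ copSet c'
        r∉S' r∈S' = copsCannotReach c c' move r∉N̄ (∈copSet⇒position c' r r∈S')
        pathInH = proj₂ (proj₁ wide) (copSet c') (fewOccupied c') r r'
                    (r∈H , r∉S') (r'∈H , λ r'∈S' → r'∉N̄' (inj₁ r'∈S'))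

    safe⇒¬copsWin : ∀ {c r} → Safe c r → ¬ CopsWin G c r
    safe⇒¬copsWin (_ , r∉N̄) (win c' move (inj₁ caught)) = copsCannotReach _ c' move r∉N̄ caught
    safe⇒¬copsWin safe      (win c' move (inj₂ continue)) with escape move safe
    ... | r' , robberMove , safe' = safe⇒¬copsWin safe' (continue r' robberMove)

    fewCopsLose : ¬ CopsWinWith G m
    fewCopsLose (c₀ , strategy) with safeVertex c₀
    ... | r , safe@(_ , r∉N̄) =
      safe⇒¬copsWin safe (strategy r (λ occ → r∉N̄ (inj₁ (occupied⇒∈copSet c₀ occ))))

lemma2p2 : (G : Graph) → Connected G → (k : ℕ) → 0 < k → (H : Subgraph G) → Wide G k H →
    ∀ (m : ℕ) → CopsWinWith G m → k ≤ m
lemma2p2 G _ k _ H wide m copsWin with k ≤? m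
... | yes k≤m = k≤m
... | no  k≰m = ⊥-elim (FewCops.fewCopsLose G k H wide m (≰⇒> k≰m) copsWin)
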